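{- Let $V$ be a three-dimensional vector space over a field $K$ with basis $e_1,e_2,e_3$, and let $\pi_{23}\in GL(V)$ be defined by $e_1\mapsto e_1$, $e_2\mapsto e_3$, $e_3\mapsto e_2$. Let $\varphi\in GL(V)$ preserve the multiset of lines $$\{1\cdot\langle e_1\rangle,\ 4\cdot\langle e_2\rangle,\ 4\cdot\langle e_3\rangle,\ 2\cdot\langle e_1-e_2\rangle,\ 2\cdot\langle e_1-e_3\rangle\}$$ (the coefficients denoting multiplicities). Then $\varphi=\lambda\,\mathrm{id}_V$ or $\varphi=\lambda\pi_{23}$ for some $\lambda\in K^\ast$.
   Context: $\langle v\rangle$ denotes the line spanned by $v$. Preserving a multiset of lines means that $\varphi$ permutes the lines so that each line is sent to a line of the same multiplicity. -}

module Defs where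

open import Level using (_⊔_; suc)
open import Algebra.Bundles using (CommutativeRing)
open import Data.Nat using (ℕ)
open import Data.Fin using (Fin)
open import Data.Fin.Patterns using (0F; 1F; 2F; 3F; 4F)
open import Data.Fin.Permutation using (Permutation′; _⟨$⟩ʳ_)
open import Data.Product using (Σ; _×_; ∃)
open import Data.Sum using (_⊎_)
open import Relation.Nullary using (¬_)
open import Relation.Binary.PropositionalEquality using (_≡_)

record Field (c ℓ : Level.Level) : Set (Level.suc (c ⊔ ℓ)) where
  field
    commutativeRing : CommutativeRing c ℓ
  open CommutativeRing commutativeRing public
  field
    0≉1     : ¬ (0# ≈ 1#)
    inverse : ∀ x → ¬ (x ≈ 0#) → Σ Carrier (λ y → x * y ≈ 1#)

module LinAlg {c ℓ} (F : Field c ℓ) where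
  open Field F public

  -- V = K³ with standard basis e₁ e₂ e₃ (indices 0,1,2)
  V : Set c
  V = Fin 3 → Carrier

  Mat : Set c
  Mat = Fin 3 → Fin 3 → Carrier

  apply : Mat → V → V
  apply A v i = A i 0F * v 0F + A i 1F * v 1F + A i 2F * v 2F

  _∘ₘ_ : Mat → Mat → Mat
  (A ∘ₘ B) i j = apply A (λ k → B k j) i

  _≈ₘ_ : Mat → Mat → Set ℓ
  A ≈ₘ B = ∀ i j → A i j ≈ B i j

  _·ₘ_ : Carrier → Mat → Mat
  (λ' ·ₘ A) i j = λ' * A i j

  idₘ : Mat
  idₘ 0F 0F = 1#
  idₘ 1F 1F = 1#
  idₘ 2F 2F = 1#
  idₘ _  _  = 0#

  -- π₂₃ : e₁ ↦ e₁, e₂ ↦ e₃, e₃ ↦ e₂ (columns are images of basis vectors)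
  π₂₃ : Mat
  π₂₃ 0F 0F = 1#
  π₂₃ 1F 2F = 1#
  π₂₃ 2F 1F = 1#
  π₂₃ _  _  = 0#

  IsGL : Mat → Set (c ⊔ ℓ)
  IsGL A = Σ Mat (λ B → ((B ∘ₘ A) ≈ₘ idₘ) × ((A ∘ₘ B) ≈ₘ idₘ))

  SameLine : V → V → Set (c ⊔ ℓ)
  SameLine u w = Σ Carrier (λ t → ¬ (t ≈ 0#) × (∀ i → u i ≈ t * w i))

  line : Fin 5 → V
  line 0F 0F = 1#
  line 0F _  = 0#
  line 1F 1F = 1#
  line 1F _  = 0#
  line 2F 2F = 1#
  line 2F _  = 0#
  line 3F 0F = 1#
  line 3F 1F = - 1#
  line 3F _  = 0#
  line 4F 0F = 1#
  line 4F 2F = - 1#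
  line 4F _  = 0#

  mult : Fin 5 → ℕ
  mult 0F = 1
  mult 1F = 4
  mult 2F = 4
  mult 3F = 2
  mult 4F = 2

  -- φ preserves the multiset of lines: φ permutes the lines, sending each
  -- line to a line of the same multiplicity
  PreservesMultiset : Mat → Set (c ⊔ ℓ)
  PreservesMultiset A = Σ (Permutation′ 5) (λ σ → ∀ i →
    (mult (σ ⟨$⟩ʳ i) ≡ mult i) × SameLine (apply A (line i)) (line (σ ⟨$⟩ʳ i)))

-- φ fixes ⟨e₁⟩, the only line of multiplicity 1, and permutes the lines of
-- multiplicity 4 and 2 among themselves, so φ e₁ = λ e₁ and φ e₂, φ e₃ are
-- multiples of e₂, e₃ in some order.  Since φ (e₁ - e₂) = λ e₁ - φ e₂ must lie
-- on ⟨e₁ - e₂⟩ or ⟨e₁ - e₃⟩, comparing the e₁-coordinate with the coordinate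
-- of φ e₂ forces φ e₂ = λ e_j for the matching j, and likewise for φ e₃.
module Submission where

open import Defs
open import Level using (Level)
open import Data.Product using (Σ; _×_; _,_; proj₁; proj₂)
open import Data.Sum using (_⊎_; inj₁; inj₂)
open import Data.Empty using (⊥-elim)
open import Data.Fin using (Fin)
open import Data.Fin.Patterns using (0F; 1F; 2F; 3F; 4F)
open import Data.Fin.Permutation using (_⟨$⟩ʳ_)
open import Function using (_∘_; Injection)
open import Function.Properties.Inverse using (↔⇒↣)
open import Relation.Nullary using (¬_)
open import Relation.Binary.PropositionalEquality using (_≡_; _≢_; refl)
import Algebra.Properties.Ring as RingProperties

module MultisetPreserving {c ℓ} (F : Field c ℓ) where
  open LinAlg F hiding (refl)
  open RingProperties ring using (-‿distribʳ-*; -0#≈0#; -‿injective)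
  open import Relation.Binary.Reasoning.Setoid setoid

  mult≡1⇒e₁ : ∀ {k} → mult k ≡ 1 → k ≡ 0F
  mult≡1⇒e₁ {0F} _ = refl
  mult≡1⇒e₁ {1F} ()
  mult≡1⇒e₁ {2F} ()
  mult≡1⇒e₁ {3F} ()
  mult≡1⇒e₁ {4F} ()

  mult≡4⇒axis : ∀ {k} → mult k ≡ 4 → k ≡ 1F ⊎ k ≡ 2F
  mult≡4⇒axis {1F} _ = inj₁ refl
  mult≡4⇒axis {2F} _ = inj₂ refl
  mult≡4⇒axis {0F} ()
  mult≡4⇒axis {3F} ()
  mult≡4⇒axis {4F} ()

  mult≡2⇒diagonal : ∀ {k} → mult k ≡ 2 → k ≡ 3F ⊎ k ≡ 4F
  mult≡2⇒diagonal {3F} _ = inj₁ refl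
  mult≡2⇒diagonal {4F} _ = inj₂ refl
  mult≡2⇒diagonal {0F} ()
  mult≡2⇒diagonal {1F} ()
  mult≡2⇒diagonal {2F} ()

  x*-1≈-x : ∀ x → x * - 1# ≈ - x
  x*-1≈-x x = trans (sym (-‿distribʳ-* x 1#)) (-‿cong (*-identityʳ x))

  x*1-y*0≈x : ∀ x y → x * 1# - y * 0# ≈ x
  x*1-y*0≈x x y = begin
    x * 1# - y * 0#  ≈⟨ +-cong (*-identityʳ x) (-‿cong (zeroʳ y)) ⟩
    x - 0#           ≈⟨ +-congˡ -0#≈0# ⟩
    x + 0#           ≈⟨ +-identityʳ x ⟩
    x                ∎

  x*0-y*1≈-y : ∀ x y → x * 0# - y * 1# ≈ - y
  x*0-y*1≈-y x y = begin
    x * 0# - y * 1#  ≈⟨ +-cong (zeroʳ x) (-‿cong (*-identityʳ y)) ⟩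
    0# - y           ≈⟨ +-identityˡ (- y) ⟩
    - y              ∎

  apply-e₁ : ∀ A i → apply A (line 0F) i ≈ A i 0F
  apply-e₁ A i = begin
    A i 0F * 1# + A i 1F * 0# + A i 2F * 0#  ≈⟨ +-cong (+-cong (*-identityʳ _) (zeroʳ _)) (zeroʳ _) ⟩
    A i 0F + 0# + 0#                         ≈⟨ trans (+-identityʳ _) (+-identityʳ _) ⟩
    A i 0F                                   ∎

  apply-e₂ : ∀ A i → apply A (line 1F) i ≈ A i 1F
  apply-e₂ A i = begin
    A i 0F * 0# + A i 1F * 1# + A i 2F * 0#  ≈⟨ +-cong (+-cong (zeroʳ _) (*-identityʳ _)) (zeroʳ _) ⟩
    0# + A i 1F + 0#                         ≈⟨ trans (+-identityʳ _) (+-identityˡ _) ⟩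
    A i 1F                                   ∎

  apply-e₃ : ∀ A i → apply A (line 2F) i ≈ A i 2F
  apply-e₃ A i = begin
    A i 0F * 0# + A i 1F * 0# + A i 2F * 1#  ≈⟨ +-cong (+-cong (zeroʳ _) (zeroʳ _)) (*-identityʳ _) ⟩
    0# + 0# + A i 2F                         ≈⟨ trans (+-congʳ (+-identityʳ 0#)) (+-identityˡ _) ⟩
    A i 2F                                   ∎

  apply-e₁-e₂ : ∀ A i → apply A (line 3F) i ≈ A i 0F - A i 1F
  apply-e₁-e₂ A i = begin
    A i 0F * 1# + A i 1F * - 1# + A i 2F * 0#  ≈⟨ +-cong (+-cong (*-identityʳ _) (x*-1≈-x _)) (zeroʳ _) ⟩
    A i 0F - A i 1F + 0#                       ≈⟨ +-identityʳ _ ⟩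
    A i 0F - A i 1F                            ∎

  apply-e₁-e₃ : ∀ A i → apply A (line 4F) i ≈ A i 0F - A i 2F
  apply-e₁-e₃ A i = begin
    A i 0F * 1# + A i 1F * 0# + A i 2F * - 1#  ≈⟨ +-cong (+-cong (*-identityʳ _) (zeroʳ _)) (x*-1≈-x _) ⟩
    A i 0F + 0# - A i 2F                       ≈⟨ +-congʳ (+-identityʳ _) ⟩
    A i 0F - A i 2F                            ∎

  x*1-y*0≈z*1⇒x≈z : ∀ {x y z} → x * 1# - y * 0# ≈ z * 1# → x ≈ z
  x*1-y*0≈z*1⇒x≈z {x} {y} {z} h = trans (sym (x*1-y*0≈x x y)) (trans h (*-identityʳ z))

  x*0-y*1≈z*-1⇒y≈z : ∀ {x y z} → x * 0# - y * 1# ≈ z * - 1# → y ≈ z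
  x*0-y*1≈z*-1⇒y≈z {x} {y} {z} h = -‿injective (trans (sym (x*0-y*1≈-y x y)) (trans h (x*-1≈-x z)))

  x*0-y*1≈z*0⇒y≈0 : ∀ {x y z} → x * 0# - y * 1# ≈ z * 0# → y ≈ 0#
  x*0-y*1≈z*0⇒y≈0 {x} {y} {z} h =
    -‿injective (trans (sym (x*0-y*1≈-y x y)) (trans h (trans (zeroʳ z) (sym -0#≈0#))))

  -- At the e₁-coordinate t' = t₀; at the coordinate of e_a, -t = -t' if the
  -- diagonal line is ⟨e₁ - e_a⟩ and -t = 0 otherwise.
  diagonal⇒same-scale : ∀ {a d t₀ t t'} → mult a ≡ 4 → mult d ≡ 2 → ¬ t ≈ 0# →
    (∀ i → t₀ * line 0F i - t * line a i ≈ t' * line d i) → t ≈ t₀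
  diagonal⇒same-scale ma md t≉0 h with mult≡4⇒axis ma | mult≡2⇒diagonal md
  ... | inj₁ refl | inj₁ refl = trans (x*0-y*1≈z*-1⇒y≈z (h 1F)) (sym (x*1-y*0≈z*1⇒x≈z (h 0F)))
  ... | inj₁ refl | inj₂ refl = ⊥-elim (t≉0 (x*0-y*1≈z*0⇒y≈0 (h 1F)))
  ... | inj₂ refl | inj₁ refl = ⊥-elim (t≉0 (x*0-y*1≈z*0⇒y≈0 (h 2F)))
  ... | inj₂ refl | inj₂ refl = trans (x*0-y*1≈z*-1⇒y≈z (h 2F)) (sym (x*1-y*0≈z*1⇒x≈z (h 0F)))

  axis-image-rescaled : ∀ {a d} {u w : V} {t₀ t t'} → mult a ≡ 4 → mult d ≡ 2 → ¬ t ≈ 0# →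
    (∀ i → u i ≈ t₀ * line 0F i) → (∀ i → w i ≈ t * line a i) →
    (∀ i → u i - w i ≈ t' * line d i) → ∀ i → w i ≈ t₀ * line a i
  axis-image-rescaled {a = a} {d = d} {t₀ = t₀} {t = t} {t' = t'} ma md t≉0 u≈ w≈ u-w≈ i =
    trans (w≈ i) (*-congʳ (diagonal⇒same-scale ma md t≉0 coordinates))
    where
    coordinates : ∀ j → t₀ * line 0F j - t * line a j ≈ t' * line d j
    coordinates j = trans (sym (+-cong (u≈ j) (-‿cong (w≈ j)))) (u-w≈ j)

  scaled-idₘ : ∀ {A t} → (∀ i → A i 0F ≈ t * line 0F i) → (∀ i → A i 1F ≈ t * line 1F i) →
    (∀ i → A i 2F ≈ t * line 2F i) → A ≈ₘ (t ·ₘ idₘ)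
  scaled-idₘ c₀ c₁ c₂ 0F 0F = c₀ 0F
  scaled-idₘ c₀ c₁ c₂ 1F 0F = c₀ 1F
  scaled-idₘ c₀ c₁ c₂ 2F 0F = c₀ 2F
  scaled-idₘ c₀ c₁ c₂ 0F 1F = c₁ 0F
  scaled-idₘ c₀ c₁ c₂ 1F 1F = c₁ 1F
  scaled-idₘ c₀ c₁ c₂ 2F 1F = c₁ 2F
  scaled-idₘ c₀ c₁ c₂ 0F 2F = c₂ 0F
  scaled-idₘ c₀ c₁ c₂ 1F 2F = c₂ 1F
  scaled-idₘ c₀ c₁ c₂ 2F 2F = c₂ 2F

  scaled-π₂₃ : ∀ {A t} → (∀ i → A i 0F ≈ t * line 0F i) → (∀ i → A i 1F ≈ t * line 2F i) →
    (∀ i → A i 2F ≈ t * line 1F i) → A ≈ₘ (t ·ₘ π₂₃)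
  scaled-π₂₃ c₀ c₁ c₂ 0F 0F = c₀ 0F
  scaled-π₂₃ c₀ c₁ c₂ 1F 0F = c₀ 1F
  scaled-π₂₃ c₀ c₁ c₂ 2F 0F = c₀ 2F
  scaled-π₂₃ c₀ c₁ c₂ 0F 1F = c₁ 0F
  scaled-π₂₃ c₀ c₁ c₂ 1F 1F = c₁ 1F
  scaled-π₂₃ c₀ c₁ c₂ 2F 1F = c₁ 2F
  scaled-π₂₃ c₀ c₁ c₂ 0F 2F = c₂ 0F
  scaled-π₂₃ c₀ c₁ c₂ 1F 2F = c₂ 1F
  scaled-π₂₃ c₀ c₁ c₂ 2F 2F = c₂ 2F

  axes-permuted⇒scaled-idₘ-or-π₂₃ : ∀ {A a b t} → mult a ≡ 4 → mult b ≡ 4 → a ≢ b →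
    (∀ i → A i 0F ≈ t * line 0F i) → (∀ i → A i 1F ≈ t * line a i) →
    (∀ i → A i 2F ≈ t * line b i) → (A ≈ₘ (t ·ₘ idₘ)) ⊎ (A ≈ₘ (t ·ₘ π₂₃))
  axes-permuted⇒scaled-idₘ-or-π₂₃ ma mb a≢b c₀ c₁ c₂ with mult≡4⇒axis ma | mult≡4⇒axis mb
  ... | inj₁ refl | inj₁ refl = ⊥-elim (a≢b refl)
  ... | inj₁ refl | inj₂ refl = inj₁ (scaled-idₘ c₀ c₁ c₂)
  ... | inj₂ refl | inj₁ refl = inj₂ (scaled-π₂₃ c₀ c₁ c₂)
  ... | inj₂ refl | inj₂ refl = ⊥-elim (a≢b refl)

lemma5p10 : ∀ {c ℓ : Level} (F : Field c ℓ) → let open LinAlg F in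
    (φ : Mat) → IsGL φ → PreservesMultiset φ →
    Σ Carrier (λ t → ¬ (t ≈ 0#) × ((φ ≈ₘ (t ·ₘ idₘ)) ⊎ (φ ≈ₘ (t ·ₘ π₂₃))))
lemma5p10 F φ _ (σ , preserves) =
  scale 0F , scale≉0 0F ,
  axes-permuted⇒scaled-idₘ-or-π₂₃ (mult-preserved 1F) (mult-preserved 2F) σ₁≢σ₂ φe₁ φe₂ φe₃
  where
  open LinAlg F hiding (refl)
  open MultisetPreserving F

  mult-preserved : ∀ k → mult (σ ⟨$⟩ʳ k) ≡ mult k
  mult-preserved k = proj₁ (preserves k)

  scale : Fin 5 → Carrier
  scale k = proj₁ (proj₂ (preserves k))

  scale≉0 : ∀ k → ¬ (scale k ≈ 0#)
  scale≉0 k = proj₁ (proj₂ (proj₂ (preserves k)))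

  image : ∀ k i → apply φ (line k) i ≈ scale k * line (σ ⟨$⟩ʳ k) i
  image k = proj₂ (proj₂ (proj₂ (preserves k)))

  σ₁≢σ₂ : σ ⟨$⟩ʳ 1F ≢ σ ⟨$⟩ʳ 2F
  σ₁≢σ₂ = (λ ()) ∘ Injection.injective (↔⇒↣ σ)

  φe₁ : ∀ i → φ i 0F ≈ scale 0F * line 0F i
  φe₁ i with σ ⟨$⟩ʳ 0F | mult≡1⇒e₁ (mult-preserved 0F) | image 0F
  ... | _ | refl | φe₁≈ = trans (sym (apply-e₁ φ i)) (φe₁≈ i)

  φe₂ : ∀ i → φ i 1F ≈ scale 0F * line (σ ⟨$⟩ʳ 1F) i
  φe₂ = axis-image-rescaled (mult-preserved 1F) (mult-preserved 3F) (scale≉0 1F) φe₁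
    (λ i → trans (sym (apply-e₂ φ i)) (image 1F i)) (λ i → trans (sym (apply-e₁-e₂ φ i)) (image 3F i))

  φe₃ : ∀ i → φ i 2F ≈ scale 0F * line (σ ⟨$⟩ʳ 2F) i
  φe₃ = axis-image-rescaled (mult-preserved 2F) (mult-preserved 4F) (scale≉0 2F) φe₁
    (λ i → trans (sym (apply-e₃ φ i)) (image 2F i)) (λ i → trans (sym (apply-e₁-e₃ φ i)) (image 4F i))
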